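{- Let $n\ge 1$ and let $M$ be an $n\times n$ array with entries from $\{1,\ldots,n\}$, and define the binary operation $*$ on $\{1,\ldots,n\}$ by letting $a*b$ be the entry of $M$ in row $a$ and column $b$. Then $M$ has property $P_1$ if and only if $(\{1,\ldots,n\},*)$ is a rectangular groupoid.
   Context: An $n\times n$ array $M$ with entries from $\{1,\ldots,n\}$ has property $P_1$ iff whenever two distinct symbols appear together in some row, they never appear together in any column, and whenever two distinct symbols appear together in some column, they never appear together in any row. A groupoid $(A,*)$ (a set with a binary operation) is a rectangular groupoid if for all $a,b,c,d,x\in A$: $a*b=c*d=x$ implies $a*d=c*b=x$. -}

module Defs where

open import Data.Nat using (ℕ)
open import Data.Fin using (Fin)
open import Data.Product using (∃-syntax; _×_)
open import Relation.Binary.PropositionalEquality using (_≡_; _≢_)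
open import Relation.Nullary using (¬_)

-- An n×n array with entries from {1,…,n} (encoded as Fin n): M row col.
Array : ℕ → Set
Array n = Fin n → Fin n → Fin n

TogetherInRow : ∀ {n} → Array n → Fin n → Fin n → Set
TogetherInRow {n} M x y = ∃[ r ] ∃[ c ] ∃[ c' ] (M r c ≡ x × M r c' ≡ y)

TogetherInCol : ∀ {n} → Array n → Fin n → Fin n → Set
TogetherInCol {n} M x y = ∃[ c ] ∃[ r ] ∃[ r' ] (M r c ≡ x × M r' c ≡ y)

P₁ : ∀ {n} → Array n → Set
P₁ {n} M =
  (∀ (x y : Fin n) → x ≢ y → TogetherInRow M x y → ¬ TogetherInCol M x y)
  × (∀ (x y : Fin n) → x ≢ y → TogetherInCol M x y → ¬ TogetherInRow M x y)

IsRectangular : {A : Set} → (A → A → A) → Set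
IsRectangular {A} _*_ = ∀ (a b c d x : A) →
  a * b ≡ x → c * d ≡ x → (a * d ≡ x × c * b ≡ x)

module Submission where

-- (⇒) Suppose M a b ≡ x and M c d ≡ x.  The cell (a , d) shares row a with
--     the cell (a , b) and column d with the cell (c , d), so its symbol
--     appears together with x both in a row and in a column.  Property P₁
--     forbids this for distinct symbols, hence M a d ≡ x (`cornerForced`);
--     the other corner is the same fact with the two cells swapped.
-- (⇐) Suppose x and y share row r (in columns c , c') and column k (in rows
--     r₁ , r₂).  Rectangularity applied to the cells (r , c) , (r₁ , k) and
--     to (r , c') , (r₂ , k) shows that the single cell (r , k) holds both
--     x and y, so x ≡ y (`rowColumnMeet`); both halves of P₁ follow.

open import Defs
open import Data.Nat using (ℕ; _≥_)
open import Data.Fin using (Fin; _≟_)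
open import Data.Product using (_×_; _,_; proj₁)
open import Relation.Nullary using (yes; no; contradiction)
open import Relation.Binary.PropositionalEquality using (_≡_; refl; sym; trans)

module _ {n : ℕ} (M : Array n) where

  cornerForced : P₁ M → ∀ (a b c d x : Fin n) →
    M a b ≡ x → M c d ≡ x → M a d ≡ x
  cornerForced (rowsExcludeColumns , _) a b c d x ab≡x cd≡x with M a d ≟ x
  ... | yes ad≡x = ad≡x
  ... | no ad≢x  = contradiction sharedColumn
                     (rowsExcludeColumns x (M a d) (λ x≡ad → ad≢x (sym x≡ad)) sharedRow)
    where
    sharedRow : TogetherInRow M x (M a d)
    sharedRow = a , b , d , ab≡x , refl

    sharedColumn : TogetherInCol M x (M a d)
    sharedColumn = d , c , a , cd≡x , refl

  p₁⇒rectangular : P₁ M → IsRectangular M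
  p₁⇒rectangular p a b c d x ab≡x cd≡x =
    cornerForced p a b c d x ab≡x cd≡x , cornerForced p c d a b x cd≡x ab≡x

  -- In a rectangular table, two symbols sharing both a row and a column are
  -- equal: both must sit in the cell where that row and column meet.
  rowColumnMeet : IsRectangular M → ∀ {x y : Fin n} →
    TogetherInRow M x y → TogetherInCol M x y → x ≡ y
  rowColumnMeet rect {x} {y} (r , c , c' , rc≡x , rc'≡y) (k , r₁ , r₂ , r₁k≡x , r₂k≡y) =
    trans (sym rk≡x) rk≡y
    where
    rk≡x : M r k ≡ x
    rk≡x = proj₁ (rect r c r₁ k x rc≡x r₁k≡x)

    rk≡y : M r k ≡ y
    rk≡y = proj₁ (rect r c' r₂ k y rc'≡y r₂k≡y)

  rectangular⇒p₁ : IsRectangular M → P₁ M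
  rectangular⇒p₁ rect =
    (λ x y x≢y inRow inCol → x≢y (rowColumnMeet rect inRow inCol)) ,
    (λ x y x≢y inCol inRow → x≢y (rowColumnMeet rect inRow inCol))

mainTheorem1 : ∀ (n : ℕ) → n ≥ 1 → (M : Array n) →
    (P₁ M → IsRectangular M) × (IsRectangular M → P₁ M)
mainTheorem1 n _ M = p₁⇒rectangular M , rectangular⇒p₁ M
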